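{- Let $k\ge 1$, let $n_1,\dots,n_k$ be nonzero integers, and let $w=B^{n_k}JB^{n_{k-1}}J\cdots B^{n_1}J$. Then the third column $(c_1,c_2,c_3)$ of $w$ satisfies $|c_1|>|c_2|>|c_3|$, and the entry $w_{23}$ of $w$ in row $2$, column $3$ is nonzero.
   Context: $B=\begin{pmatrix}3&4&0\\2&3&0\\0&0&1\end{pmatrix}$ and $J=\begin{pmatrix}0&0&1\\0&1&0\\1&0&0\end{pmatrix}$. -}

module Defs where

open import Data.Nat using (ℕ; zero; suc)
open import Data.Integer using (ℤ; +_; -[1+_]; _+_; _*_; -_)
open import Data.Fin using (Fin; zero; suc)
open import Data.Vec using (Vec; []; _∷_)

-- 3×3 integer matrices, indexed by rows then columns (Fin 3 = {0,1,2} ~ {1,2,3}).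
Mat3 : Set
Mat3 = Fin 3 → Fin 3 → ℤ

mat : ℤ → ℤ → ℤ → ℤ → ℤ → ℤ → ℤ → ℤ → ℤ → Mat3
mat a b c d e f g h i zero    zero                = a
mat a b c d e f g h i zero    (suc zero)          = b
mat a b c d e f g h i zero    (suc (suc zero))    = c
mat a b c d e f g h i (suc zero) zero             = d
mat a b c d e f g h i (suc zero) (suc zero)       = e
mat a b c d e f g h i (suc zero) (suc (suc zero)) = f
mat a b c d e f g h i (suc (suc zero)) zero             = g
mat a b c d e f g h i (suc (suc zero)) (suc zero)       = h
mat a b c d e f g h i (suc (suc zero)) (suc (suc zero)) = i

_⊗_ : Mat3 → Mat3 → Mat3
(M ⊗ N) r c = M r zero * N zero c + M r (suc zero) * N (suc zero) c
            + M r (suc (suc zero)) * N (suc (suc zero)) c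

I₃ : Mat3
I₃ = mat (+ 1) (+ 0) (+ 0) (+ 0) (+ 1) (+ 0) (+ 0) (+ 0) (+ 1)

B : Mat3
B = mat (+ 3) (+ 4) (+ 0) (+ 2) (+ 3) (+ 0) (+ 0) (+ 0) (+ 1)

-- Inverse of B (det B = 1).
Binv : Mat3
Binv = mat (+ 3) (- (+ 4)) (+ 0) (- (+ 2)) (+ 3) (+ 0) (+ 0) (+ 0) (+ 1)

J : Mat3
J = mat (+ 0) (+ 0) (+ 1) (+ 0) (+ 1) (+ 0) (+ 1) (+ 0) (+ 0)

_^ₙ_ : Mat3 → ℕ → Mat3
M ^ₙ zero  = I₃
M ^ₙ suc m = M ⊗ (M ^ₙ m)

Bpow : ℤ → Mat3
Bpow (+ m)      = B ^ₙ m
Bpow -[1+ m ]   = Binv ^ₙ suc m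

-- word (n₁ ∷ n₂ ∷ … ∷ nₖ ∷ []) = B^{nₖ} J B^{nₖ₋₁} J ⋯ B^{n₁} J
word : ∀ {k} → Vec ℤ k → Mat3
word []       = I₃
word (n ∷ ns) = word ns ⊗ (Bpow n ⊗ J)

module Submission where

-- Proof idea.  The third column of w = B^{n_k} J ⋯ B^{n_1} J is w·e₃, so we follow the
-- column vector v = (x, y, z) through the factors B^{n} J, starting from e₃.
--
--  * B, B⁻¹ and J preserve the quadratic form Q(x, y, z) = x² + z² − 2y² (B is a Pell
--    automorphism of x² − 2y²), hence Q(v) = 1 throughout.
--  * Orientation cones: for a sign s = ±1, B maps the wedge {s(x+y) > 0, s·y ≥ 0} into the
--    cone {s·x > s·y > 0}, which lies in the wedge; so every positive power of B maps the
--    wedge into the cone.  Vectors with |x| < |y|, and e₁, lie in a wedge, and the cone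
--    forces 0 < |y| < |x|.  Negative powers reduce to positive ones, as B⁻¹ = D B D for
--    D = diag(1, −1, 1), and all these conditions are invariant under D.
--  * If Q(v) = 1 and 0 < |y| < |x|, then x² + z² = 1 + 2y² forces |z| < |y|.  Hence J·v
--    (which swaps x and z) again satisfies |x| < |y|, and the next factor applies.

open import Defs
open import Data.Nat using (ℕ; _≤_; _>_)
open import Data.Integer using (ℤ; ∣_∣; 0ℤ)
open import Data.Fin using (Fin; zero; suc)
open import Data.Vec using (Vec; lookup)
open import Data.Product using (_×_)
open import Relation.Binary.PropositionalEquality using (_≢_)

import Data.Nat as ℕ
open import Data.Nat using (suc; z<s)
open import Data.Nat.GeneralisedArithmetic using (fold)
import Data.Nat.Properties as ℕₚ
import Data.Nat.Tactic.RingSolver as ℕ-Solver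
open import Data.Integer using (+_; -[1+_]; +[1+_]; 1ℤ; -1ℤ; _+_; _*_; -_; _-_)
open import Data.Integer.Properties
  using (+-comm; ∣-i∣≡∣i∣; -1*i≡-i; *-identityˡ; neg-involutive; +-injective; +◃n≡+n; pos-*; n⊖n≡0)
open import Data.Integer.Tactic.RingSolver using (solve-∀)
open import Data.Vec using ([]; _∷_)
open import Data.Product using (Σ; ∃-syntax; _,_)
open import Data.Sum using (_⊎_; inj₁; inj₂)
open import Relation.Nullary using (yes; no; contradiction)
open import Relation.Binary.PropositionalEquality
  using (_≡_; refl; sym; trans; cong; cong₂; subst; subst₂; module ≡-Reasoning)

pattern i₁ = zero
pattern i₂ = suc zero
pattern i₃ = suc (suc zero)

V3 : Set
V3 = ℤ × ℤ × ℤ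

e₃ : V3
e₃ = + 0 , + 0 , + 1

≡-coords : ∀ {a b c a′ b′ c′ : ℤ} → a ≡ a′ → b ≡ b′ → c ≡ c′ → (a , b , c) ≡ (a′ , b′ , c′)
≡-coords refl refl refl = refl

coord : Mat3 → Fin 3 → V3 → ℤ
coord M r (x , y , z) = M r i₁ * x + M r i₂ * y + M r i₃ * z

_·_ : Mat3 → V3 → V3
M · v = coord M i₁ v , coord M i₂ v , coord M i₃ v

·-⊗ : ∀ M N v → (M ⊗ N) · v ≡ M · (N · v)
·-⊗ M N (x , y , z) = ≡-coords (row i₁) (row i₂) (row i₃)
  where
  assoc : ∀ a₁ a₂ a₃ n₁₁ n₁₂ n₁₃ n₂₁ n₂₂ n₂₃ n₃₁ n₃₂ n₃₃ x y z →
    (a₁ * n₁₁ + a₂ * n₂₁ + a₃ * n₃₁) * x + (a₁ * n₁₂ + a₂ * n₂₂ + a₃ * n₃₂) * y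
      + (a₁ * n₁₃ + a₂ * n₂₃ + a₃ * n₃₃) * z
    ≡ a₁ * (n₁₁ * x + n₁₂ * y + n₁₃ * z) + a₂ * (n₂₁ * x + n₂₂ * y + n₂₃ * z)
      + a₃ * (n₃₁ * x + n₃₂ * y + n₃₃ * z)
  assoc = solve-∀
  row : ∀ r → coord (M ⊗ N) r (x , y , z) ≡ coord M r (N · (x , y , z))
  row r = assoc (M r i₁) (M r i₂) (M r i₃)
                (N i₁ i₁) (N i₁ i₂) (N i₁ i₃) (N i₂ i₁) (N i₂ i₂) (N i₂ i₃)
                (N i₃ i₁) (N i₃ i₂) (N i₃ i₃) x y z

pick₁ : ∀ x y z → + 1 * x + + 0 * y + + 0 * z ≡ x
pick₁ = solve-∀

pick₂ : ∀ x y z → + 0 * x + + 1 * y + + 0 * z ≡ y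
pick₂ = solve-∀

pick₃ : ∀ x y z → + 0 * x + + 0 * y + + 1 * z ≡ z
pick₃ = solve-∀

·-I₃ : ∀ v → I₃ · v ≡ v
·-I₃ (x , y , z) = ≡-coords (pick₁ x y z) (pick₂ x y z) (pick₃ x y z)

·-e₃ : ∀ M → M · e₃ ≡ (M i₁ i₃ , M i₂ i₃ , M i₃ i₃)
·-e₃ M = ≡-coords (third (M i₁ i₁) (M i₁ i₂) (M i₁ i₃)) (third (M i₂ i₁) (M i₂ i₂) (M i₂ i₃))
                   (third (M i₃ i₁) (M i₃ i₂) (M i₃ i₃))
  where
  third : ∀ a b c → a * + 0 + b * + 0 + c * + 1 ≡ c
  third = solve-∀

swap : V3 → V3
swap (x , y , z) = z , y , x

·-J : ∀ v → J · v ≡ swap v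
·-J (x , y , z) = ≡-coords (pick₃ x y z) (pick₂ x y z) (pick₁ x y z)

β : V3 → V3
β (x , y , z) = + 3 * x + + 4 * y , + 2 * x + + 3 * y , z

·-B : ∀ v → B · v ≡ β v
·-B (x , y , z) = ≡-coords (row₁ x y z) (row₂ x y z) (pick₃ x y z)
  where
  row₁ : ∀ x y z → + 3 * x + + 4 * y + + 0 * z ≡ + 3 * x + + 4 * y
  row₁ = solve-∀
  row₂ : ∀ x y z → + 2 * x + + 3 * y + + 0 * z ≡ + 2 * x + + 3 * y
  row₂ = solve-∀

flip : V3 → V3
flip (x , y , z) = x , - y , z

flip-involutive : ∀ v → flip (flip v) ≡ v
flip-involutive (x , y , z) = cong (λ t → x , t , z) (neg-involutive y)

·-Binv : ∀ v → Binv · v ≡ flip (β (flip v))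
·-Binv (x , y , z) = ≡-coords (row₁ x y z) (row₂ x y z) (pick₃ x y z)
  where
  row₁ : ∀ x y z → + 3 * x + - (+ 4) * y + + 0 * z ≡ + 3 * x + + 4 * (- y)
  row₁ = solve-∀
  row₂ : ∀ x y z → - (+ 2) * x + + 3 * y + + 0 * z ≡ - (+ 2 * x + + 3 * (- y))
  row₂ = solve-∀

·-^ₙ : ∀ M f → (∀ v → M · v ≡ f v) → ∀ m v → (M ^ₙ m) · v ≡ fold v f m
·-^ₙ M f M≗f ℕ.zero v = ·-I₃ v
·-^ₙ M f M≗f (suc m) v = begin
  (M ⊗ (M ^ₙ m)) · v   ≡⟨ ·-⊗ M (M ^ₙ m) v ⟩
  M · ((M ^ₙ m) · v)   ≡⟨ M≗f _ ⟩
  f ((M ^ₙ m) · v)     ≡⟨ cong f (·-^ₙ M f M≗f m v) ⟩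
  f (fold v f m)       ∎
  where open ≡-Reasoning

fold-conjugate : ∀ {A : Set} (h f : A → A) → (∀ a → h (h a) ≡ a) →
                 ∀ m a → fold a (λ b → h (f (h b))) m ≡ h (fold (h a) f m)
fold-conjugate h f invol ℕ.zero a = sym (invol a)
fold-conjugate h f invol (suc m) a = begin
  h (f (h (fold a g m)))              ≡⟨ cong (λ b → h (f (h b))) (fold-conjugate h f invol m a) ⟩
  h (f (h (h (fold (h a) f m))))      ≡⟨ cong (λ b → h (f b)) (invol _) ⟩
  h (f (fold (h a) f m))              ∎
  where
  open ≡-Reasoning
  g = λ b → h (f (h b))

·-Binv^ₙ : ∀ m v → (Binv ^ₙ m) · v ≡ flip (fold (flip v) β m)
·-Binv^ₙ m v = trans (·-^ₙ Binv _ ·-Binv m v) (fold-conjugate flip β flip-involutive m v)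

Q : V3 → ℤ
Q (x , y , z) = x * x + z * z - + 2 * (y * y)

Q-β : ∀ v → Q (β v) ≡ Q v
Q-β (x , y , z) = pell x y z
  where
  pell : ∀ x y z → (+ 3 * x + + 4 * y) * (+ 3 * x + + 4 * y) + z * z
                     - + 2 * ((+ 2 * x + + 3 * y) * (+ 2 * x + + 3 * y))
                   ≡ x * x + z * z - + 2 * (y * y)
  pell = solve-∀

Q-flip : ∀ v → Q (flip v) ≡ Q v
Q-flip (x , y , z) = cong (λ t → x * x + z * z - + 2 * t) (square-neg y)
  where
  square-neg : ∀ y → - y * - y ≡ y * y
  square-neg = solve-∀

Q-swap : ∀ v → Q (swap v) ≡ Q v
Q-swap (x , y , z) = cong (_- + 2 * (y * y)) (+-comm (z * z) (x * x))

Q-fold : ∀ f → (∀ v → Q (f v) ≡ Q v) → ∀ m v → Q (fold v f m) ≡ Q v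
Q-fold f Q-f ℕ.zero v = refl
Q-fold f Q-f (suc m) v = trans (Q-f _) (Q-fold f Q-f m v)

Pos : ℤ → Set
Pos d = ∃[ k ] d ≡ +[1+ k ]

NonNeg : ℤ → Set
NonNeg d = ∃[ k ] d ≡ + k

pos⇒nonneg : ∀ {d} → Pos d → NonNeg d
pos⇒nonneg (k , eq) = suc k , eq

pos+nonneg : ∀ {p q} → Pos p → NonNeg q → Pos (p + q)
pos+nonneg (k , refl) (j , refl) = k ℕ.+ j , refl

scale-pos : ∀ a {p} → Pos p → Pos (+[1+ a ] * p)
scale-pos a (k , refl) = _ , refl

x+∣x∣-nonneg : ∀ x → NonNeg (x + + ∣ x ∣)
x+∣x∣-nonneg (+ n) = n ℕ.+ n , refl
x+∣x∣-nonneg -[1+ n ] = 0 , n⊖n≡0 (suc n)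

shift-pos : ∀ x {n} → ∣ x ∣ ℕ.< n → Pos (x + + n)
shift-pos x ∣x∣<n with ℕₚ.m≤n⇒∃[o]m+o≡n ∣x∣<n
... | o , refl = subst Pos (regroup x (+ ∣ x ∣) (+ o)) (pos+nonneg (o , refl) (x+∣x∣-nonneg x))
  where
  regroup : ∀ x a o → (+ 1 + o) + (x + a) ≡ x + (+ 1 + (a + o))
  regroup = solve-∀

Unit : ℤ → Set
Unit s = s ≡ 1ℤ ⊎ s ≡ -1ℤ

∣unit*∣ : ∀ {s} → Unit s → ∀ t → ∣ s * t ∣ ≡ ∣ t ∣
∣unit*∣ (inj₁ refl) t = cong ∣_∣ (*-identityˡ t)
∣unit*∣ (inj₂ refl) t = trans (cong ∣_∣ (-1*i≡-i t)) (∣-i∣≡∣i∣ t)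

Cone : ℤ → V3 → Set
Cone s (x , y , _) = Pos (s * y) × Pos (s * (x - y))

Wedge : ℤ → V3 → Set
Wedge s (x , y , _) = Pos (s * (x + y)) × NonNeg (s * y)

cone⇒wedge : ∀ s v → Cone s v → Wedge s v
cone⇒wedge s (x , y , _) (s*y>0 , s*[x-y]>0) =
  subst Pos (sum x y s) (pos+nonneg s*[x-y]>0 (pos⇒nonneg (scale-pos 1 s*y>0))) , pos⇒nonneg s*y>0
  where
  sum : ∀ x y s → s * (x - y) + + 2 * (s * y) ≡ s * (x + y)
  sum = solve-∀

β-wedge : ∀ s v → Wedge s v → Cone s (β v)
β-wedge s (x , y , _) (s*[x+y]>0 , s*y≥0) =
  subst Pos (new-y x y s) (pos+nonneg (scale-pos 1 s*[x+y]>0) s*y≥0) , subst Pos (new-x-y x y s) s*[x+y]>0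
  where
  new-y : ∀ x y s → + 2 * (s * (x + y)) + s * y ≡ s * (+ 2 * x + + 3 * y)
  new-y = solve-∀
  new-x-y : ∀ x y s → s * (x + y) ≡ s * ((+ 3 * x + + 4 * y) - (+ 2 * x + + 3 * y))
  new-x-y = solve-∀

β-power-cone : ∀ s v → Wedge s v → ∀ m → Cone s (fold v β (suc m))
β-power-cone s v wedge ℕ.zero = β-wedge s v wedge
β-power-cone s v wedge (suc m) =
  β-wedge s (fold v β (suc m)) (cone⇒wedge s (fold v β (suc m)) (β-power-cone s v wedge m))

Dominant : V3 → Set
Dominant (x , y , _) = 0 ℕ.< ∣ y ∣ × ∣ y ∣ ℕ.< ∣ x ∣

cone⇒dominant : ∀ {s} → Unit s → ∀ v → Cone s v → Dominant v
cone⇒dominant {s} unit (x , y , _) ((k , s*y≡) , (j , s*[x-y]≡)) =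
  subst (0 ℕ.<_) ∣y∣≡ z<s , subst₂ ℕ._<_ ∣y∣≡ ∣x∣≡ (ℕₚ.m<m+n (suc k) z<s)
  where
  split : ∀ x y s → s * x ≡ s * y + s * (x - y)
  split = solve-∀
  ∣y∣≡ : suc k ≡ ∣ y ∣
  ∣y∣≡ = trans (cong ∣_∣ (sym s*y≡)) (∣unit*∣ unit y)
  ∣x∣≡ : suc k ℕ.+ suc j ≡ ∣ x ∣
  ∣x∣≡ = trans (cong ∣_∣ (sym (trans (split x y s) (cong₂ _+_ s*y≡ s*[x-y]≡)))) (∣unit*∣ unit x)

-- Vectors that a power of B can be applied to: |x| < |y|, or (x, y) = (1, 0) as for e₁.
Ready : V3 → Set
Ready (x , y , _) = ∣ x ∣ ℕ.< ∣ y ∣ ⊎ (x ≡ 1ℤ × y ≡ 0ℤ)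

ready⇒wedge : ∀ v → Ready v → Σ ℤ λ s → Unit s × Wedge s v
ready⇒wedge (x , + 0 , _) (inj₁ ())
ready⇒wedge (x , +[1+ k ] , _) (inj₁ ∣x∣<∣y∣) =
  1ℤ , inj₁ refl , subst Pos (sym (*-identityˡ _)) (shift-pos x ∣x∣<∣y∣) , _ , refl
ready⇒wedge (x , -[1+ k ] , _) (inj₁ ∣x∣<∣y∣) =
  -1ℤ , inj₂ refl ,
  subst Pos (negate x -[1+ k ]) (shift-pos (- x) (subst (ℕ._< suc k) (sym (∣-i∣≡∣i∣ x)) ∣x∣<∣y∣)) ,
  _ , refl
  where
  negate : ∀ x y → - x + - y ≡ -1ℤ * (x + y)
  negate = solve-∀
ready⇒wedge _ (inj₂ (refl , refl)) = 1ℤ , inj₁ refl , (0 , refl) , (0 , refl)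

square-abs : ∀ x → x * x ≡ + (∣ x ∣ ℕ.* ∣ x ∣)
square-abs (+ n) = +◃n≡+n (n ℕ.* n)
square-abs -[1+ n ] = +◃n≡+n (suc n ℕ.* suc n)

Q≡1-ℕ : ∀ x y z → Q (x , y , z) ≡ 1ℤ →
        ∣ x ∣ ℕ.* ∣ x ∣ ℕ.+ ∣ z ∣ ℕ.* ∣ z ∣ ≡ 1 ℕ.+ 2 ℕ.* (∣ y ∣ ℕ.* ∣ y ∣)
Q≡1-ℕ x y z Q≡1 = +-injective (begin
  + (∣ x ∣ ℕ.* ∣ x ∣) + + (∣ z ∣ ℕ.* ∣ z ∣) ≡⟨ cong₂ _+_ (square-abs x) (square-abs z) ⟨
  x * x + z * z                           ≡⟨ rearrange x y z ⟩
  Q (x , y , z) + + 2 * (y * y)           ≡⟨ cong₂ (λ q t → q + + 2 * t) Q≡1 (square-abs y) ⟩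
  + 1 + + 2 * + (∣ y ∣ ℕ.* ∣ y ∣)         ≡⟨ cong (λ t → + 1 + t) (pos-* 2 (∣ y ∣ ℕ.* ∣ y ∣)) ⟨
  + (1 ℕ.+ 2 ℕ.* (∣ y ∣ ℕ.* ∣ y ∣))       ∎)
  where
  open ≡-Reasoning
  rearrange : ∀ x y z → x * x + z * z ≡ (x * x + z * z - + 2 * (y * y)) + + 2 * (y * y)
  rearrange = solve-∀

-- If 0 < Y < X and X² + Z² = 1 + 2Y², then Z < Y: otherwise X² + Z² ≥ (Y+1)² + Y² > 1 + 2Y².
gap-ℕ : ∀ {X Y Z} → 0 ℕ.< Y → Y ℕ.< X → X ℕ.* X ℕ.+ Z ℕ.* Z ≡ 1 ℕ.+ 2 ℕ.* (Y ℕ.* Y) → Z ℕ.< Y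
gap-ℕ {X} {suc k} {Z} _ Y<X norm with Z ℕ.<? suc k
... | yes Z<Y = Z<Y
... | no Z≮Y = contradiction (sym norm) (ℕₚ.<⇒≢ (begin-strict
  1 ℕ.+ 2 ℕ.* (Y ℕ.* Y)                 <⟨ ℕₚ.m<m+n (1 ℕ.+ 2 ℕ.* (Y ℕ.* Y)) z<s ⟩
  1 ℕ.+ 2 ℕ.* (Y ℕ.* Y) ℕ.+ 2 ℕ.* Y     ≡⟨ square-step Y ⟩
  (1 ℕ.+ Y) ℕ.* (1 ℕ.+ Y) ℕ.+ Y ℕ.* Y   ≤⟨ ℕₚ.+-mono-≤ (ℕₚ.*-mono-≤ Y<X Y<X) (ℕₚ.*-mono-≤ Y≤Z Y≤Z) ⟩
  X ℕ.* X ℕ.+ Z ℕ.* Z                   ∎))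
  where
  open ℕₚ.≤-Reasoning
  Y = suc k
  Y≤Z = ℕₚ.≮⇒≥ Z≮Y
  square-step : ∀ Y → 1 ℕ.+ 2 ℕ.* (Y ℕ.* Y) ℕ.+ 2 ℕ.* Y ≡ (1 ℕ.+ Y) ℕ.* (1 ℕ.+ Y) ℕ.+ Y ℕ.* Y
  square-step = ℕ-Solver.solve-∀

-- Following the column vector along the word.  The loop invariant: Q(v) = 1 and 0 < |y| < |x|.
Reachable : V3 → Set
Reachable v = Q v ≡ 1ℤ × Dominant v

gap : ∀ x y z → Reachable (x , y , z) → ∣ z ∣ ℕ.< ∣ y ∣
gap x y z (Q≡1 , 0<∣y∣ , ∣y∣<∣x∣) = gap-ℕ 0<∣y∣ ∣y∣<∣x∣ (Q≡1-ℕ x y z Q≡1)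

reachable-shape : ∀ x y z → Reachable (x , y , z) → (∣ x ∣ > ∣ y ∣ × ∣ y ∣ > ∣ z ∣) × y ≢ 0ℤ
reachable-shape x y z r@(_ , 0<∣y∣ , ∣y∣<∣x∣) =
  (∣y∣<∣x∣ , gap x y z r) , λ { refl → ℕₚ.<-irrefl refl 0<∣y∣ }

β-power-reachable : ∀ u → Ready u → Q u ≡ 1ℤ → ∀ m → Reachable (fold u β (suc m))
β-power-reachable u ready Q≡1 m with ready⇒wedge u ready
... | s , unit , wedge =
  trans (Q-fold β Q-β (suc m) u) Q≡1 , cone⇒dominant unit (fold u β (suc m)) (β-power-cone s u wedge m)

-- Ready and Reachable are invariant under D, which transports the result to B⁻¹.
ready-flip : ∀ v → Ready v → Ready (flip v)
ready-flip (x , y , _) (inj₁ ∣x∣<∣y∣) = inj₁ (subst (∣ x ∣ ℕ.<_) (sym (∣-i∣≡∣i∣ y)) ∣x∣<∣y∣)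
ready-flip _ (inj₂ (x≡1 , refl)) = inj₂ (x≡1 , refl)

reachable-flip : ∀ v → Reachable v → Reachable (flip v)
reachable-flip (x , y , z) (Q≡1 , dominant) =
  trans (Q-flip (x , y , z)) Q≡1 ,
  subst (λ n → 0 ℕ.< n × n ℕ.< ∣ x ∣) (sym (∣-i∣≡∣i∣ y)) dominant

-- The same for any nonzero power of B; negative powers via B⁻ᵐ = D Bᵐ D.
power-reachable : ∀ n u → n ≢ 0ℤ → Ready u → Q u ≡ 1ℤ → Reachable (Bpow n · u)
power-reachable (+ 0) u n≢0 _ _ = contradiction refl n≢0
power-reachable +[1+ m ] u _ ready Q≡1 =
  subst Reachable (sym (·-^ₙ B β ·-B (suc m) u)) (β-power-reachable u ready Q≡1 m)
power-reachable -[1+ m ] u _ ready Q≡1 =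
  subst Reachable (sym (·-Binv^ₙ (suc m) u))
    (reachable-flip (fold (flip u) β (suc m))
      (β-power-reachable (flip u) (ready-flip u ready) (trans (Q-flip u) Q≡1) m))

Admissible : V3 → Set
Admissible v = v ≡ e₃ ⊎ Reachable v

admissible-Q : ∀ v → Admissible v → Q v ≡ 1ℤ
admissible-Q _ (inj₁ refl) = refl
admissible-Q _ (inj₂ (Q≡1 , _)) = Q≡1

-- J turns an admissible vector into a ready one: e₃ into e₁, and (x, y, z) into
-- (z, y, x), where |z| < |y| by the gap.
admissible⇒ready : ∀ v → Admissible v → Ready (swap v)
admissible⇒ready _ (inj₁ refl) = inj₂ (refl , refl)
admissible⇒ready (x , y , z) (inj₂ reachable) = inj₁ (gap x y z reachable)

factor-reachable : ∀ n v → n ≢ 0ℤ → Admissible v → Reachable ((Bpow n ⊗ J) · v)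
factor-reachable n v n≢0 adm =
  subst Reachable (sym (trans (·-⊗ (Bpow n) J v) (cong (Bpow n ·_) (·-J v))))
    (power-reachable n (swap v) n≢0 (admissible⇒ready v adm) (trans (Q-swap v) (admissible-Q v adm)))

word-reachable : ∀ {k} n (ns : Vec ℤ k) → (∀ i → lookup (n ∷ ns) i ≢ 0ℤ) →
                 ∀ v → Admissible v → Reachable (word (n ∷ ns) · v)
word-reachable n [] nonzero v adm =
  subst Reachable (sym (trans (·-⊗ I₃ (Bpow n ⊗ J) v) (·-I₃ ((Bpow n ⊗ J) · v))))
    (factor-reachable n v (nonzero zero) adm)
word-reachable n (m ∷ ns) nonzero v adm =
  subst Reachable (sym (·-⊗ (word (m ∷ ns)) (Bpow n ⊗ J) v))
    (word-reachable m ns (λ i → nonzero (suc i)) _ (inj₂ (factor-reachable n v (nonzero zero) adm)))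

lemma5p5 : (k : ℕ) → 1 ≤ k → (ns : Vec ℤ k) → (∀ i → lookup ns i ≢ 0ℤ) →
    ((∣ word ns zero (suc (suc zero)) ∣ > ∣ word ns (suc zero) (suc (suc zero)) ∣)
     × (∣ word ns (suc zero) (suc (suc zero)) ∣ > ∣ word ns (suc (suc zero)) (suc (suc zero)) ∣))
    × word ns (suc zero) (suc (suc zero)) ≢ 0ℤ
lemma5p5 (suc k) _ (n ∷ ns) nonzero =
  reachable-shape (w i₁ i₃) (w i₂ i₃) (w i₃ i₃)
    (subst Reachable (·-e₃ w) (word-reachable n ns nonzero e₃ (inj₁ refl)))
  where
  w : Mat3
  w = word (n ∷ ns)
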